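{- For every $k\in\mathbb{N}$, $\mathcal{G}_k$ is not the class of all finite simple graphs; i.e. there exists a finite simple graph $G$ such that no pair of $k$-uniform words $w,v$ (over any alphabet in bijection with $V(G)$) satisfies $G\cong G(w,v)$.
   Context: For a word $w$, $\mathrm{alph}(w)$ is the set of letters occurring in $w$ and $|w|_a$ the number of occurrences of $a$; $w$ is $k$-uniform if $|w|_a=k$ for all $a\in\mathrm{alph}(w)$. For letters $a,b$, $\pi_{a,b}$ is the monoid morphism on words with $a\mapsto a$, $b\mapsto b$ and all other letters mapped to the empty word. For words $w,v$ with $\mathrm{alph}(w)=\mathrm{alph}(v)=A$, $G(w,v)$ is the undirected simple graph on vertex set $A$ in which distinct $a,b$ are adjacent iff $\pi_{a,b}(w)=\pi_{a,b}(v)$. For $k\in\mathbb{N}$, $\mathcal{G}_k$ is the set of graphs $G$ for which there exist $k$-uniform words $w,v\in V(G)^\ast$ with $G=G(w,v)$. -}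

module Defs where

open import Data.Nat using (ℕ)
open import Data.Bool using (Bool; true; false)
open import Data.Fin using (Fin; _≟_)
open import Data.List using (List; filter; length)
open import Data.List.Membership.Propositional using (_∈_)
open import Data.Product using (Σ; _×_; ∃)
open import Relation.Binary.PropositionalEquality using (_≡_; _≢_)
open import Relation.Nullary.Decidable using (_⊎-dec_)
open import Function.Bundles using (_⇔_)

record SimpleGraph : Set where
  field
    n     : ℕ
    adj   : Fin n → Fin n → Bool
    sym   : ∀ a b → adj a b ≡ adj b a
    irref : ∀ a → adj a a ≡ false
open SimpleGraph public

Word : ℕ → Set
Word n = List (Fin n)

occ : ∀ {n} → Fin n → Word n → ℕ
occ a w = length (filter (λ x → x ≟ a) w)

proj : ∀ {n} → Fin n → Fin n → Word n → Word n
proj a b w = filter (λ x → (x ≟ a) ⊎-dec (x ≟ b)) w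

AlphAll : ∀ {n} → Word n → Set
AlphAll {n} w = (a : Fin n) → a ∈ w

Uniform : ∀ {n} → ℕ → Word n → Set
Uniform k w = ∀ a → a ∈ w → occ a w ≡ k

IsG : (G : SimpleGraph) → Word (n G) → Word (n G) → Set
IsG G w v = ∀ a b → a ≢ b → (adj G a b ≡ true) ⇔ (proj a b w ≡ proj a b v)

InGk : ℕ → SimpleGraph → Set
InGk k G = Σ (Word (n G)) λ w → Σ (Word (n G)) λ v →
  AlphAll w × AlphAll v × Uniform k w × Uniform k v × IsG G w v

module Submission where

open import Defs hiding (sym)

open import Algebra.Properties.CommutativeMonoid.Sum as Sum using ()
open import Data.Bool using (Bool; true; false)
open import Data.Fin as Fin
  using (Fin; zero; suc; _↑ˡ_; _↑ʳ_; splitAt; combine; remQuot; finToFun; funToFin; punchIn)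
import Data.Fin.Properties as FinP
open import Data.List using ([]; _∷_; [_]; _++_; length; filter)
import Data.List.Properties as ListP
open import Data.Nat using (ℕ; zero; suc; _+_; _*_; _^_; _≤_; _<_; z≤n; s≤s; NonZero; >-nonZero)
import Data.Nat.Properties as ℕP
open import Data.Nat.Tactic.RingSolver using (solve-∀)
open import Data.Product as Product using (∃; _,_; _×_; proj₁; proj₂; uncurry)
open import Data.Sum using (_⊎_; inj₁; inj₂)
open import Function using (_∘_; Inverse)
open import Function.Bundles using (_⇔_; Equivalence)
open import Relation.Binary.PropositionalEquality
  using (_≡_; _≢_; refl; sym; trans; cong; cong₂; subst; module ≡-Reasoning)
open import Relation.Nullary using (¬_; Dec; yes; no; does; contradiction)

-- The bipartite graphs with two sides of p vertices correspond to the 2^(p²) relations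
-- Fin p → Fin p → Bool, and such a graph G(w,v) is determined by the pair (w,v): l and r
-- are adjacent iff π_{l,r}(w) = π_{l,r}(v). A k-uniform word over 2p letters has length
-- at most 2pk, so it is one of at most (2p+1)^(2pk) padded words. For p = 2^(4k+5) there
-- are fewer than 2^(p²) such pairs, so some bipartite graph is not in 𝒢_k; membership in
-- the image of the finite coding map is decidable, so that graph is found constructively.

open Sum ℕP.+-0-commutativeMonoid
  using (sum; sum-syntax; sum-cong-≗; ∑-distrib-+; sum-remove; sum-replicate-zero)

sum≤n*k : ∀ {n} k (f : Fin n → ℕ) → (∀ a → f a ≤ k) → sum f ≤ n * k
sum≤n*k {zero} k f f≤k = z≤n
sum≤n*k {suc n} k f f≤k = ℕP.+-mono-≤ (f≤k zero) (sum≤n*k k (f ∘ suc) (f≤k ∘ suc))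

occ-++ : ∀ {n} (a : Fin n) u w → occ a (u ++ w) ≡ occ a u + occ a w
occ-++ a u w = trans (cong length (ListP.filter-++ (Fin._≟ a) u w)) (ListP.length-++ (filter (Fin._≟ a) u))

∑-occ-singleton : ∀ {n} (x : Fin n) → ∑[ a < n ] occ a [ x ] ≡ 1
∑-occ-singleton {suc n} x = begin
  ∑[ a < suc n ] occ a [ x ]                        ≡⟨ sum-remove {i = x} (λ a → occ a [ x ]) ⟩
  occ x [ x ] + ∑[ j < n ] occ (punchIn x j) [ x ]  ≡⟨ cong₂ _+_ occ-self (sum-cong-≗ occ-other) ⟩
  1 + ∑[ j < n ] 0                                  ≡⟨ cong (1 +_) (sum-replicate-zero n) ⟩
  1                                                 ∎
  where
  open ≡-Reasoning
  occ-self : occ x [ x ] ≡ 1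
  occ-self = cong length (ListP.filter-accept (Fin._≟ x) refl)
  occ-other : ∀ j → occ (punchIn x j) [ x ] ≡ 0
  occ-other j = cong length (ListP.filter-reject (Fin._≟ punchIn x j) (FinP.punchInᵢ≢i x j ∘ sym))

length≡∑occ : ∀ {n} (w : Word n) → length w ≡ ∑[ a < n ] occ a w
length≡∑occ {n} [] = sym (sum-replicate-zero n)
length≡∑occ {n} (x ∷ w) = begin
  suc (length w)                               ≡⟨ cong₂ _+_ (sym (∑-occ-singleton x)) (length≡∑occ w) ⟩
  ∑[ a < n ] occ a [ x ] + ∑[ a < n ] occ a w  ≡⟨ sym (∑-distrib-+ (λ a → occ a [ x ]) (λ a → occ a w)) ⟩
  ∑[ a < n ] (occ a [ x ] + occ a w)           ≡⟨ sum-cong-≗ (λ a → sym (occ-++ a [ x ] w)) ⟩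
  ∑[ a < n ] occ a (x ∷ w)                     ∎
  where open ≡-Reasoning

Uniform⇒length≤ : ∀ {n} k (w : Word n) → AlphAll w → Uniform k w → length w ≤ n * k
Uniform⇒length≤ k w alph unif = subst (_≤ _) (sym (length≡∑occ w))
  (sum≤n*k k (λ a → occ a w) (λ a → ℕP.≤-reflexive (unif a (alph a))))

-- Words of length ≤ L as functions Fin L → Fin (suc n), padded with the blank zero.
pad : ∀ {n} L → Word n → Fin L → Fin (suc n)
pad (suc L) []      _       = zero
pad (suc L) (x ∷ w) zero    = suc x
pad (suc L) (x ∷ w) (suc t) = pad L w t

consUnlessBlank : ∀ {n} → Fin (suc n) → Word n → Word n
consUnlessBlank zero    _ = []
consUnlessBlank (suc x) w = x ∷ w

unpad : ∀ {n} L → (Fin L → Fin (suc n)) → Word n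
unpad zero    f = []
unpad (suc L) f = consUnlessBlank (f zero) (unpad L (f ∘ suc))

unpad-cong : ∀ {n} L {f g : Fin L → Fin (suc n)} → (∀ t → f t ≡ g t) → unpad L f ≡ unpad L g
unpad-cong zero    f≗g = refl
unpad-cong (suc L) f≗g = cong₂ consUnlessBlank (f≗g zero) (unpad-cong L (f≗g ∘ suc))

unpad-pad : ∀ {n} L (w : Word n) → length w ≤ L → unpad L (pad L w) ≡ w
unpad-pad zero    []      _         = refl
unpad-pad (suc L) []      _         = refl
unpad-pad (suc L) (x ∷ w) (s≤s w≤L) = cong (x ∷_) (unpad-pad L w w≤L)

encodeWord : ∀ {n} L → Word n → Fin (suc n ^ L)
encodeWord L w = funToFin (pad L w)

decodeWord : ∀ {n} L → Fin (suc n ^ L) → Word n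
decodeWord L c = unpad L (finToFun c)

decodeWord-encodeWord : ∀ {n} L (w : Word n) → length w ≤ L → decodeWord L (encodeWord L w) ≡ w
decodeWord-encodeWord L w w≤L =
  trans (unpad-cong L (FinP.finToFun-funToFin (pad L w))) (unpad-pad L w w≤L)

encodePair : ∀ {n} L → Word n → Word n → Fin (suc n ^ L * suc n ^ L)
encodePair L w v = combine (encodeWord L w) (encodeWord L v)

decodePair : ∀ {n} L → Fin (suc n ^ L * suc n ^ L) → Word n × Word n
decodePair {n} L x = Product.map (decodeWord L) (decodeWord L) (remQuot (suc n ^ L) x)

decodePair-encodePair : ∀ {n} L (w v : Word n) → length w ≤ L → length v ≤ L →
                        decodePair L (encodePair L w v) ≡ (w , v)
decodePair-encodePair L w v w≤L v≤L =
  trans (cong (Product.map (decodeWord L) (decodeWord L)) (FinP.remQuot-combine _ _))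
        (cong₂ _,_ (decodeWord-encodeWord L w w≤L) (decodeWord-encodeWord L v v≤L))

bipartiteAdj : ∀ {p q} → (Fin p → Fin q → Bool) → Fin p ⊎ Fin q → Fin p ⊎ Fin q → Bool
bipartiteAdj R (inj₁ _) (inj₁ _) = false
bipartiteAdj R (inj₁ l) (inj₂ r) = R l r
bipartiteAdj R (inj₂ r) (inj₁ l) = R l r
bipartiteAdj R (inj₂ _) (inj₂ _) = false

bipartiteAdj-sym : ∀ {p q} (R : Fin p → Fin q → Bool) x y → bipartiteAdj R x y ≡ bipartiteAdj R y x
bipartiteAdj-sym R (inj₁ _) (inj₁ _) = refl
bipartiteAdj-sym R (inj₁ _) (inj₂ _) = refl
bipartiteAdj-sym R (inj₂ _) (inj₁ _) = refl
bipartiteAdj-sym R (inj₂ _) (inj₂ _) = refl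

bipartiteAdj-irrefl : ∀ {p q} (R : Fin p → Fin q → Bool) x → bipartiteAdj R x x ≡ false
bipartiteAdj-irrefl R (inj₁ _) = refl
bipartiteAdj-irrefl R (inj₂ _) = refl

bipartite : ∀ {p q} → (Fin p → Fin q → Bool) → SimpleGraph
bipartite {p} {q} R = record
  { n     = p + q
  ; adj   = λ a b → bipartiteAdj R (splitAt p a) (splitAt p b)
  ; sym   = λ a b → bipartiteAdj-sym R (splitAt p a) (splitAt p b)
  ; irref = λ a → bipartiteAdj-irrefl R (splitAt p a)
  }

bipartite-adj : ∀ {p q} (R : Fin p → Fin q → Bool) l r → adj (bipartite R) (l ↑ˡ q) (p ↑ʳ r) ≡ R l r
bipartite-adj {p} {q} R l r rewrite FinP.splitAt-↑ˡ p l q | FinP.splitAt-↑ʳ p q r = refl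

↑ˡ≢↑ʳ : ∀ {p q} (l : Fin p) (r : Fin q) → l ↑ˡ q ≢ p ↑ʳ r
↑ˡ≢↑ʳ {p} {q} l r eq
  with () ← trans (sym (FinP.splitAt-↑ˡ p l q)) (trans (cong (splitAt p) eq) (FinP.splitAt-↑ʳ p q r))

projAgree : ∀ {p q} → Word (p + q) → Word (p + q) → Fin p → Fin q → Bool
projAgree {p} {q} w v l r = does (ListP.≡-dec Fin._≟_ (proj (l ↑ˡ q) (p ↑ʳ r) w)
                                                      (proj (l ↑ˡ q) (p ↑ʳ r) v))

does-unique : ∀ {P : Set} (b : Bool) (P? : Dec P) → (b ≡ true ⇔ P) → b ≡ does P?
does-unique true  (yes _)  _   = refl
does-unique true  (no ¬P)  b⇔P = contradiction (Equivalence.to b⇔P refl) ¬P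
does-unique false (yes P)  b⇔P = Equivalence.from b⇔P P
does-unique false (no _)   _   = refl

IsG-bipartite⇒projAgree : ∀ {p q} (R : Fin p → Fin q → Bool) {w v} → IsG (bipartite R) w v →
                          ∀ l r → R l r ≡ projAgree w v l r
IsG-bipartite⇒projAgree {p} {q} R isG l r = trans (sym (bipartite-adj R l r))
  (does-unique _ (ListP.≡-dec Fin._≟_ _ _) (isG (l ↑ˡ q) (p ↑ʳ r) (↑ˡ≢↑ʳ l r)))

open Inverse FinP.2↔Bool using ()
  renaming (to to toBool; from to fromBool; strictlyInverseʳ to fromBool-toBool)

relation : ∀ {p q} → Fin (2 ^ (p * q)) → Fin p → Fin q → Bool
relation {p} {q} i l r = toBool (finToFun {2} {p * q} i (combine l r))

relationCode : ∀ {p q} → (Fin p → Fin q → Bool) → Fin (2 ^ (p * q))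
relationCode {p} {q} R = funToFin (fromBool ∘ uncurry R ∘ remQuot q)

funToFin-cong : ∀ {m n} {f g : Fin m → Fin n} → (∀ t → f t ≡ g t) → funToFin f ≡ funToFin g
funToFin-cong {zero}  f≗g = refl
funToFin-cong {suc m} f≗g = cong₂ combine (f≗g zero) (funToFin-cong (f≗g ∘ suc))

relationCode-relation : ∀ {p q} (i : Fin (2 ^ (p * q))) {R} → (∀ l r → relation i l r ≡ R l r) →
                        relationCode R ≡ i
relationCode-relation {p} {q} i {R} i≗R =
  trans (funToFin-cong bit≡) (FinP.funToFin-finToFin {p * q} {2} i)
  where
  open ≡-Reasoning
  bits : Fin (p * q) → Fin 2
  bits = finToFun i
  bit≡ : ∀ t → fromBool (uncurry R (remQuot {p} q t)) ≡ bits t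
  bit≡ t = begin
    fromBool (R l r)                        ≡⟨ cong fromBool (sym (i≗R l r)) ⟩
    fromBool (toBool (bits (combine l r)))  ≡⟨ fromBool-toBool _ ⟩
    bits (combine l r)                      ≡⟨ cong bits (FinP.combine-remQuot {p} q t) ⟩
    bits t                                  ∎
    where
    l : Fin p
    l = proj₁ (remQuot {p} q t)
    r : Fin q
    r = proj₂ (remQuot {p} q t)

agreementCode : ∀ p L → Fin (suc (p + p) ^ L * suc (p + p) ^ L) → Fin (2 ^ (p * p))
agreementCode p L = relationCode ∘ uncurry (projAgree {p} {p}) ∘ decodePair L

InGk-bipartite⇒agreementCode : ∀ k p (i : Fin (2 ^ (p * p))) →
                               InGk k (bipartite (relation {p} {p} i)) →
                               ∃ λ x → agreementCode p ((p + p) * k) x ≡ i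
InGk-bipartite⇒agreementCode k p i (w , v , alph-w , alph-v , unif-w , unif-v , isG) =
  encodePair L w v , (begin
    code (decodePair L (encodePair L w v))
      ≡⟨ cong code (decodePair-encodePair L w v (Uniform⇒length≤ k w alph-w unif-w)
                                                (Uniform⇒length≤ k v alph-v unif-v)) ⟩
    code (w , v)
      ≡⟨ relationCode-relation i (IsG-bipartite⇒projAgree (relation {p} {p} i) {w} {v} isG) ⟩
    i ∎)
  where
  open ≡-Reasoning
  L : ℕ
  L = (p + p) * k
  code : Word (p + p) × Word (p + p) → Fin (2 ^ (p * p))
  code = relationCode ∘ uncurry (projAgree {p} {p})

<⇒∃-notInImage : ∀ {m n} → m < n → (f : Fin m → Fin n) → ∃ λ i → ¬ (∃ λ x → f x ≡ i)
<⇒∃-notInImage {m} {n} m<n f =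
  FinP.¬∀⟶∃¬ n (λ i → ∃ λ x → f x ≡ i) (λ i → FinP.any? (λ x → f x Fin.≟ i)) ¬surjective
  where
  ¬surjective : ¬ (∀ i → ∃ λ x → f x ≡ i)
  ¬surjective hit = FinP.<⇒notInjective {f = proj₁ ∘ hit} m<n λ {i} {j} eq →
    trans (sym (proj₂ (hit i))) (trans (cong f eq) (proj₂ (hit j)))

∃-bipartite-¬InGk : ∀ k p → suc (p + p) ^ ((p + p) * k) * suc (p + p) ^ ((p + p) * k) < 2 ^ (p * p) →
                    ∃ λ (R : Fin p → Fin p → Bool) → ¬ InGk k (bipartite R)
∃-bipartite-¬InGk k p fewer
  with i , notInImage ← <⇒∃-notInImage fewer (agreementCode p ((p + p) * k)) =
  relation i , notInImage ∘ InGk-bipartite⇒agreementCode k p i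

[5+n]²<2^[5+n] : ∀ n → (5 + n) * (5 + n) < 2 ^ (5 + n)
[5+n]²<2^[5+n] zero    = ℕP.m≤m+n 26 6
[5+n]²<2^[5+n] (suc n) = begin-strict
  (6 + n) * (6 + n)                      ≡⟨ expand n ⟩
  (5 + n) * (5 + n) + (11 + 2 * n)       ≤⟨ ℕP.+-monoʳ-≤ ((5 + n) * (5 + n)) 11+2n≤[5+n]² ⟩
  (5 + n) * (5 + n) + (5 + n) * (5 + n)  <⟨ ℕP.+-mono-< ([5+n]²<2^[5+n] n) ([5+n]²<2^[5+n] n) ⟩
  2 ^ (5 + n) + 2 ^ (5 + n)              ≡⟨ cong (2 ^ (5 + n) +_) (sym (ℕP.+-identityʳ _)) ⟩
  2 ^ (6 + n)                            ∎
  where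
  open ℕP.≤-Reasoning
  expand : ∀ n → (6 + n) * (6 + n) ≡ (5 + n) * (5 + n) + (11 + 2 * n)
  expand = solve-∀
  split : ∀ n → (5 + n) * (5 + n) ≡ (11 + 2 * n) + (14 + 8 * n + n * n)
  split = solve-∀
  11+2n≤[5+n]² : 11 + 2 * n ≤ (5 + n) * (5 + n)
  11+2n≤[5+n]² = subst (11 + 2 * n ≤_) (sym (split n)) (ℕP.m≤m+n _ _)

n*[7+n]<2^[5+n] : ∀ n → n * (7 + n) < 2 ^ (5 + n)
n*[7+n]<2^[5+n] n =
  ℕP.≤-<-trans (subst (n * (7 + n) ≤_) (sym (split n)) (ℕP.m≤m+n _ _)) ([5+n]²<2^[5+n] n)
  where
  split : ∀ n → (5 + n) * (5 + n) ≡ n * (7 + n) + (3 * n + 25)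
  split = solve-∀

1+2n≤4n : ∀ n → 1 ≤ n → suc (n + n) ≤ 2 * (2 * n)
1+2n≤4n (suc n) _ = subst (suc (suc n + suc n) ≤_) (sym (split n)) (ℕP.m≤m+n _ _)
  where
  split : ∀ n → 2 * (2 * suc n) ≡ suc (suc n + suc n) + suc (2 * n)
  split = solve-∀

codes<relations : ∀ k p e → suc (p + p) ≤ 2 ^ e → 4 * k * e < p →
                  suc (p + p) ^ ((p + p) * k) * suc (p + p) ^ ((p + p) * k) < 2 ^ (p * p)
codes<relations k p e 1+2p≤2^e 4ke<p = begin-strict
  suc (p + p) ^ L * suc (p + p) ^ L  ≤⟨ ℕP.*-mono-≤ S≤ S≤ ⟩
  2 ^ (e * L) * 2 ^ (e * L)          ≡⟨ sym (ℕP.^-distribˡ-+-* 2 (e * L) (e * L)) ⟩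
  2 ^ (e * L + e * L)                ≡⟨ cong (2 ^_) (exponent k p e) ⟩
  2 ^ (4 * k * e * p)                <⟨ ℕP.^-monoʳ-< 2 (s≤s (s≤s z≤n)) (ℕP.*-monoˡ-< p 4ke<p) ⟩
  2 ^ (p * p)                        ∎
  where
  open ℕP.≤-Reasoning
  instance
    p≢0 : NonZero p
    p≢0 = >-nonZero (ℕP.≤-<-trans z≤n 4ke<p)
  L : ℕ
  L = (p + p) * k
  S≤ : suc (p + p) ^ L ≤ 2 ^ (e * L)
  S≤ = ℕP.≤-trans (ℕP.^-monoˡ-≤ L 1+2p≤2^e) (ℕP.≤-reflexive (ℕP.^-*-assoc 2 e L))
  exponent : ∀ k p e → e * ((p + p) * k) + e * ((p + p) * k) ≡ 4 * k * e * p
  exponent = solve-∀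

theorem9 : (k : ℕ) → ∃ λ (G : SimpleGraph) → ¬ InGk k G
theorem9 k = bipartite (proj₁ missing) , proj₂ missing
  where
  -- p = 2^m gives 2p + 1 ≤ 2^(2+m), and m = 5 + 4k makes 4k(2+m) < 2^m.
  m : ℕ
  m = 5 + 4 * k
  p : ℕ
  p = 2 ^ m
  missing : ∃ λ (R : Fin p → Fin p → Bool) → ¬ InGk k (bipartite R)
  missing = ∃-bipartite-¬InGk k p
    (codes<relations k p (2 + m) (1+2n≤4n p (ℕP.m^n>0 2 m)) (n*[7+n]<2^[5+n] (4 * k)))
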